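{- For $n\ge2$, the map $\kappa:\mathrm{NC}^{\mathrm{NN}}_{\{0,\pm1\}}(n-1)\to\overline{\mathrm{NC}}^{\mathrm{NN}}(n)$ is a bijection.
   Context: $[m]=\{1,\dots,m\}$. An edge of a partition of $[m]$ is a pair $(i,j)$, $i<j$, in the same block with no element of that block strictly between. $\mathrm{NC}(m)$: partitions of $[m]$ with no two edges $(a,b),(c,d)$, $a<c<b<d$. A block $B$ of $\sigma$ is nonnested if no edge $(i,j)$ has $i<\min B\le\max B<j$. $\mathrm{NC}^{\mathrm{NN}}(m)$ is the set of pairs $(\sigma,X)$ with $\sigma\in\mathrm{NC}(m)$ and $X$ a set of nonnested blocks of $\sigma$. $\mathrm{NC}^{\mathrm{NN}}_{\{0,\pm1\}}(m)$ is the set of triples $(\sigma,X,\epsilon)$ with $(\sigma,X)\in\mathrm{NC}^{\mathrm{NN}}(m)$, $\epsilon\in\{ -1,0,1\}$, and $\epsilon=0$ if $X=\emptyset$. $\overline{\mathrm{NC}}^{\mathrm{NN}}(n)$ is the set of $(\sigma,X)\in\mathrm{NC}^{\mathrm{NN}}(n)$ such that any block $A\in X$ containing $n$ has $|A|\ge2$. For $(\sigma,X,\epsilon)\in\mathrm{NC}^{\mathrm{NN}}_{\{0,\pm1\}}(n-1)$ with $X=\{A_1,\dots,A_k\}$, $\max A_1<\cdots<\max A_k$, $\kappa(\sigma,X,\epsilon)=(\sigma',X')$ where: if $\epsilon=0$, $\sigma'=\sigma\cup\{\{n\}\}$ and $X'=X$; if $\epsilon=1$, $\sigma'$ is obtained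 from $\sigma$ by adding $n$ to $A_k$ and $X'$ is $X$ (with $A_k$ replaced by $A_k\cup\{n\}$); if $\epsilon=-1$, $\sigma'$ is obtained by adding $n$ to $A_k$ and $X'=X\setminus\{A_k\}$. -}

module Defs where

open import Data.Nat using (ℕ; zero; suc; _≤_; _⊔_; _≟_)
open import Data.Fin using (Fin; _<_)
open import Data.Vec using (Vec; []; _∷_; lookup; _∷ʳ_; count; last)
open import Data.List using (List; []; _∷_; filter)
open import Data.List.Relation.Unary.All using (All)
open import Data.List.Relation.Unary.Linked using (Linked)
open import Data.Maybe using (Maybe; just; nothing)
open import Data.Bool using (Bool; true; false; if_then_else_; _∨_)
open import Data.Product using (_×_; _,_; ∃)
open import Data.Unit using (⊤)
open import Relation.Nullary using (¬_; does; ¬?)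
open import Relation.Binary.PropositionalEquality using (_≡_; _≢_)
import Data.Nat as ℕ

-- The ground set [m] = {1,…,m} is represented by Fin m = {0,…,m-1}
-- (element i+1 ↦ index i; order preserved).  A set partition σ of [m] is
-- represented canonically by its restricted growth string: σ : Vec ℕ m where
-- lookup σ i is the label of the block containing i, blocks being labelled
-- 0,1,2,… in order of their minima.  A block is identified with its label.
-- A set X of blocks is a strictly increasing list of labels (canonical form
-- of a finite set).

-- restricted growth condition, b = number of blocks seen so far
RGSFrom : {k : ℕ} → ℕ → Vec ℕ k → Set
RGSFrom b []       = ⊤
RGSFrom b (x ∷ xs) = (x ≤ b) × RGSFrom (b ⊔ suc x) xs

IsRGS : {m : ℕ} → Vec ℕ m → Set
IsRGS σ = RGSFrom 0 σ

numBlocks : {k : ℕ} → Vec ℕ k → ℕ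
numBlocks []       = 0
numBlocks (x ∷ xs) = suc x ⊔ numBlocks xs

IsBlock : {m : ℕ} → Vec ℕ m → ℕ → Set
IsBlock {m} σ ℓ = ∃ λ (i : Fin m) → lookup σ i ≡ ℓ

Edge : {m : ℕ} → Vec ℕ m → Fin m → Fin m → Set
Edge {m} σ i j =
  (i < j) × (lookup σ i ≡ lookup σ j) ×
  (∀ (k : Fin m) → i < k → k < j → lookup σ k ≢ lookup σ i)

NonCrossing : {m : ℕ} → Vec ℕ m → Set
NonCrossing {m} σ = ∀ (a b c d : Fin m) → Edge σ a b → Edge σ c d →
  ¬ ((a < c) × (c < b) × (b < d))

NonNested : {m : ℕ} → Vec ℕ m → ℕ → Set
NonNested {m} σ ℓ = ∀ (i j : Fin m) → Edge σ i j →
  ¬ (∀ (x : Fin m) → lookup σ x ≡ ℓ → (i < x) × (x < j))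

IsNCNN : (m : ℕ) → Vec ℕ m × List ℕ → Set
IsNCNN m (σ , X) =
  IsRGS σ × NonCrossing σ × Linked ℕ._<_ X ×
  All (λ ℓ → IsBlock σ ℓ × NonNested σ ℓ) X

data Eps : Set where
  neg zer pos : Eps

IsNCNN± : (m : ℕ) → Vec ℕ m × List ℕ × Eps → Set
IsNCNN± m (σ , X , ε) = IsNCNN m (σ , X) × (X ≡ [] → ε ≡ zer)

blockSize : {m : ℕ} → Vec ℕ m → ℕ → ℕ
blockSize σ ℓ = count (_≟ ℓ) σ

-- overline NC^NN(m+1) (the paper's n = m+1); its last element n is index m
IsNCNNbar : (m : ℕ) → Vec ℕ (suc m) × List ℕ → Set
IsNCNNbar m (σ , X) = IsNCNN (suc m) (σ , X) ×
  All (λ ℓ → last σ ≡ ℓ → 2 ≤ blockSize σ ℓ) X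

elemᵇ : ℕ → List ℕ → Bool
elemᵇ x []       = false
elemᵇ x (y ∷ ys) = does (x ≟ y) ∨ elemᵇ x ys

-- label of the last element of σ lying in a block of X, i.e. the block A_k
-- of X with the largest maximum (blocks are disjoint)
lastIn : {k : ℕ} → List ℕ → Vec ℕ k → Maybe ℕ
lastIn X []       = nothing
lastIn X (x ∷ xs) with lastIn X xs
... | just a  = just a
... | nothing = if elemᵇ x X then just x else nothing

remove : ℕ → List ℕ → List ℕ
remove a X = filter (λ y → ¬? (y ≟ a)) X

-- κ : NC^NN_{0,±1}(m) → overline NC^NN(m+1); new element n = m+1 is index m.
-- (the 'nothing' branches only occur when X = [], excluded for ε = ±1)
κ : {m : ℕ} → Vec ℕ m × List ℕ × Eps → Vec ℕ (suc m) × List ℕ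
κ (σ , X , zer) = (σ ∷ʳ numBlocks σ , X)
κ (σ , X , pos) with lastIn X σ
... | just a  = (σ ∷ʳ a , X)
... | nothing = (σ ∷ʳ numBlocks σ , X)
κ (σ , X , neg) with lastIn X σ
... | just a  = (σ ∷ʳ a , remove a X)
... | nothing = (σ ∷ʳ numBlocks σ , X)

module Submission where

-- Everything reduces to comparing a partition σ of [m] with its extension
-- σ ∷ʳ v, where the new element n gets label v.  The edges of σ ∷ʳ v are
-- those of σ plus at most one new edge (c , n), present exactly when v occurs
-- in σ, c being its last occurrence.  So noncrossing and nonnestedness pass
-- between σ and σ ∷ʳ v once the edges of σ passing over c are controlled, by
-- the "edge over" lemma: a position strictly between two elements of a block
-- it does not belong to lies under an edge of that block.

open import Defs
open import Data.Nat as ℕ using (ℕ; zero; suc; _≤_; _⊔_; z≤n; s≤s; _≡ᵇ_)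
import Data.Nat.Properties as ℕₚ
open import Data.Fin using (Fin; zero; suc; inject₁; fromℕ; _<_)
open import Data.Fin.Properties
  using (toℕ-inject₁; toℕ-fromℕ; toℕ<n; ≤fromℕ; <-cmp; any?; _<?_)
open import Data.Fin.Relation.Unary.Top using (view; ‵fromℕ; ‵inject₁)
open import Data.Vec using (Vec; []; _∷_; lookup; _∷ʳ_; last; initLast)
open import Data.Vec.Properties using (∷ʳ-injective; last-∷ʳ)
open import Data.List using (List; []; _∷_)
open import Data.List.Properties using (filter-accept; filter-reject; filter-all)
open import Data.List.Relation.Unary.All as All using (All; []; _∷_)
open import Data.List.Relation.Unary.AllPairs using (_∷_)
open import Data.List.Relation.Unary.Any using (here; there)
open import Data.List.Membership.Propositional using (_∈_; _∉_)
open import Data.List.Membership.Propositional.Properties using (∈-filter⁻)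
open import Data.List.Membership.DecPropositional ℕ._≟_ using (_∈?_)
open import Data.List.Relation.Unary.Linked as Linked using (Linked; [-]; _∷_)
open import Data.List.Relation.Unary.Linked.Properties using (filter⁺; Linked⇒AllPairs)
open import Data.Maybe using (Maybe; just; nothing)
open import Data.Bool using (true; false)
open import Data.Product using (_×_; _,_; ∃; ∃₂; proj₁; proj₂)
open import Data.Sum using (_⊎_; inj₁; inj₂)
open import Data.Empty using (⊥; ⊥-elim)
open import Data.Unit using (tt)
open import Function using (_∘_)
open import Relation.Nullary using (¬_; yes; no; Dec; ¬?)
open import Relation.Nullary.Decidable using (_×-dec_)
open import Relation.Nullary.Reflects using (Reflects; ofʸ; ofⁿ; fromEquivalence)
open import Relation.Unary using (Decidable)
open import Relation.Binary.PropositionalEquality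
open import Relation.Binary.Definitions using (tri<; tri≈; tri>)

least : ∀ {n} {P : Fin n → Set} → Decidable P → ∃ P →
        ∃ λ c → P c × (∀ y → y < c → ¬ P y)
least {suc n} P? w with P? zero
... | yes p₀ = zero , p₀ , λ _ ()
least {suc n} P? (zero , p)  | no ¬p₀ = ⊥-elim (¬p₀ p)
least {suc n} {P} P? (suc i , p) | no ¬p₀ with least (P? ∘ suc) (i , p)
... | c , pc , below = suc c , pc , before
  where
  before : ∀ y → y < suc c → ¬ P y
  before zero    _         = ¬p₀
  before (suc y) (s≤s y<c) = below y y<c

greatest : ∀ {n} {P : Fin n → Set} → Decidable P → ∃ P →
           ∃ λ c → P c × (∀ y → c < y → ¬ P y)
greatest {suc n} {P} P? w with any? (P? ∘ suc)
... | yes w′ with greatest (P? ∘ suc) w′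
...   | c , pc , above = suc c , pc , after
  where
  after : ∀ y → suc c < y → ¬ P y
  after (suc y) (s≤s c<y) = above y c<y
greatest {suc n} {P} P? (zero , p)  | no none = zero , p , after
  where
  after : ∀ y → zero {n} < y → ¬ P y
  after (suc y) _ py = none (y , py)
greatest {suc n} P? (suc i , p) | no none = ⊥-elim (none (i , p))

record LastWith {k} (P : ℕ → Set) (σ : Vec ℕ k) (c : Fin k) : Set where
  constructor lastWith
  field
    holds : P (lookup σ c)
    later : ∀ y → c < y → ¬ P (lookup σ y)

open LastWith using (holds)

LastOcc : ∀ {k} → Vec ℕ k → ℕ → Fin k → Set
LastOcc σ v = LastWith (_≡ v) σ

lastWith-unique : ∀ {k} {P : ℕ → Set} {σ : Vec ℕ k} {c c′} →
                  LastWith P σ c → LastWith P σ c′ → c ≡ c′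
lastWith-unique {c = c} {c′} (lastWith pc afterc) (lastWith pc′ afterc′) with <-cmp c c′
... | tri< c<c′ _ _ = ⊥-elim (afterc c′ c<c′ pc′)
... | tri≈ _ c≡c′ _ = c≡c′
... | tri> _ _ c′<c = ⊥-elim (afterc′ c c′<c pc)

lastWith-exists : ∀ {k} {P : ℕ → Set} → (∀ x → Dec (P x)) →
                  (σ : Vec ℕ k) (i : Fin k) → P (lookup σ i) → ∃ (LastWith P σ)
lastWith-exists P? σ i p with greatest (P? ∘ lookup σ) (i , p)
... | c , pc , after = c , lastWith pc after

lastIn⇒lastOcc : ∀ {k} {X : List ℕ} {σ : Vec ℕ k} {c} →
                 LastWith (_∈ X) σ c → LastOcc σ (lookup σ c) c
lastIn⇒lastOcc {X = X} (lastWith c∈X after) =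
  lastWith refl λ y c<y y≡c → after y c<y (subst (_∈ X) (sym y≡c) c∈X)

-- If x < p < y, x and y lie in one block and p does not, then some edge
-- (a , b) of that block passes over p, with b ≤ y: take a the last element
-- of the block before p and b the first one after p.
edge-over : ∀ {k} (σ : Vec ℕ k) {x p y} → lookup σ x ≡ lookup σ y →
            x < p → p < y → lookup σ p ≢ lookup σ x →
            ∃₂ λ a b → Edge σ a b × a < p × p < b × ¬ y < b
edge-over σ {x} {p} {y} x~y x<p p<y p≁x
  with greatest (λ k → (k <? p) ×-dec (lookup σ k ℕ.≟ lookup σ x)) (x , x<p , refl)
     | least (λ k → (p <? k) ×-dec (lookup σ k ℕ.≟ lookup σ x)) (y , p<y , sym x~y)
... | a , (a<p , a~x) , above | b , (p<b , b~x) , below =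
  a , b , (ℕₚ.<-trans a<p p<b , trans a~x (sym b~x) , gap) , a<p , p<b ,
  λ y<b → below y y<b (p<y , sym x~y)
  where
  gap : ∀ k → a < k → k < b → lookup σ k ≢ lookup σ a
  gap k a<k k<b k~a with <-cmp k p
  ... | tri< k<p _ _ = above k a<k (k<p , trans k~a a~x)
  ... | tri≈ _ refl _ = p≁x (trans k~a a~x)
  ... | tri> _ _ p<k = below k k<b (p<k , trans k~a a~x)

NoEdgeOver : ∀ {k} → Vec ℕ k → Fin k → Set
NoEdgeOver σ c = ∀ a b → Edge σ a b → a < c → c < b → ⊥

-- In a noncrossing σ whose block v is nonnested, no edge passes over the
-- last occurrence c of v: it would either enclose block v, or be crossed by
-- the edge of block v passing over its left end.
lastOcc-uncovered : ∀ {k} {σ : Vec ℕ k} {v c} → NonCrossing σ → NonNested σ v →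
                    LastOcc σ v c → NoEdgeOver σ c
lastOcc-uncovered {σ = σ} {v} {c} nc nn (lastWith c~v after) a b ab@(_ , _ , gap) a<c c<b
  with lookup σ a ℕ.≟ v
... | yes a~v = gap c a<c c<b (trans c~v (sym a~v))
... | no a≁v = nn a b ab encloses
  where
  encloses : ∀ x → lookup σ x ≡ v → (a < x) × (x < b)
  encloses x x~v with <-cmp x a
  ... | tri≈ _ refl _ = ⊥-elim (a≁v x~v)
  ... | tri> _ _ a<x = a<x , ℕₚ.≤-<-trans (ℕₚ.≮⇒≥ (λ c<x → after x c<x x~v)) c<b
  ... | tri< x<a _ _ with edge-over σ (trans x~v (sym c~v)) x<a a<c (a≁v ∘ λ a~x → trans a~x x~v)
  ...   | a′ , b′ , a′b′ , a′<a , a<b′ , c≮b′ =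
    ⊥-elim (nc a′ b′ a b a′b′ ab (a′<a , a<b′ , ℕₚ.≤-<-trans (ℕₚ.≮⇒≥ c≮b′) c<b))

lookup-old : ∀ {A : Set} {m} (σ : Vec A m) v i → lookup (σ ∷ʳ v) (inject₁ i) ≡ lookup σ i
lookup-old (x ∷ σ) v zero    = refl
lookup-old (x ∷ σ) v (suc i) = lookup-old σ v i

lookup-new : ∀ {A : Set} {m} (σ : Vec A m) v → lookup (σ ∷ʳ v) (fromℕ m) ≡ v
lookup-new []      v = refl
lookup-new (x ∷ σ) v = lookup-new σ v

inject₁-mono : ∀ {m} {i j : Fin m} → i < j → inject₁ i < inject₁ j
inject₁-mono {i = i} {j} = subst₂ ℕ._<_ (sym (toℕ-inject₁ i)) (sym (toℕ-inject₁ j))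

inject₁-reflect : ∀ {m} {i j : Fin m} → inject₁ i < inject₁ j → i < j
inject₁-reflect {i = i} {j} = subst₂ ℕ._<_ (toℕ-inject₁ i) (toℕ-inject₁ j)

inject₁<fromℕ : ∀ {m} (i : Fin m) → inject₁ i < fromℕ m
inject₁<fromℕ {m} i = subst₂ ℕ._<_ (sym (toℕ-inject₁ i)) (sym (toℕ-fromℕ m)) (toℕ<n i)

fromℕ-top : ∀ {m} (y : Fin (suc m)) → ¬ fromℕ m < y
fromℕ-top y n<y = ℕₚ.<-irrefl refl (ℕₚ.<-≤-trans n<y (≤fromℕ y))

module Extension {m : ℕ} (σ : Vec ℕ m) (v : ℕ) where

  σ⁺ : Vec ℕ (suc m)
  σ⁺ = σ ∷ʳ v

  private
    old : ∀ i → lookup σ⁺ (inject₁ i) ≡ lookup σ i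
    old = lookup-old σ v

    new : lookup σ⁺ (fromℕ m) ≡ v
    new = lookup-new σ v

  edge-old⁻ : ∀ {i j} → Edge σ⁺ (inject₁ i) (inject₁ j) → Edge σ i j
  edge-old⁻ {i} {j} (i<j , i~j , gap) =
    inject₁-reflect i<j , trans (sym (old i)) (trans i~j (old j)) ,
    λ k i<k k<j k~i → gap (inject₁ k) (inject₁-mono i<k) (inject₁-mono k<j)
                          (trans (old k) (trans k~i (sym (old i))))

  edge-old⁺ : ∀ {i j} → Edge σ i j → Edge σ⁺ (inject₁ i) (inject₁ j)
  edge-old⁺ {i} {j} (i<j , i~j , gap) =
    inject₁-mono i<j , trans (old i) (trans i~j (sym (old j))) , gap⁺
    where
    gap⁺ : ∀ k → inject₁ i < k → k < inject₁ j → lookup σ⁺ k ≢ lookup σ⁺ (inject₁ i)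
    gap⁺ k i<k k<j with view k
    ... | ‵fromℕ      = ⊥-elim (fromℕ-top (inject₁ j) k<j)
    ... | ‵inject₁ k₀ = λ k~i → gap k₀ (inject₁-reflect i<k) (inject₁-reflect k<j)
                                    (trans (sym (old k₀)) (trans k~i (old i)))

  edge-new⁻ : ∀ {c} → Edge σ⁺ (inject₁ c) (fromℕ m) → LastOcc σ v c
  edge-new⁻ {c} (_ , c~n , gap) =
    lastWith c~v λ y c<y y~v → gap (inject₁ y) (inject₁-mono c<y) (inject₁<fromℕ y)
                            (trans (old y) (trans y~v (sym (trans (old c) c~v))))
    where
    c~v : lookup σ c ≡ v
    c~v = trans (sym (old c)) (trans c~n new)

  edge-new⁺ : ∀ {c} → LastOcc σ v c → Edge σ⁺ (inject₁ c) (fromℕ m)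
  edge-new⁺ {c} (lastWith c~v after) =
    inject₁<fromℕ c , trans (old c) (trans c~v (sym new)) , gap
    where
    gap : ∀ k → inject₁ c < k → k < fromℕ m → lookup σ⁺ k ≢ lookup σ⁺ (inject₁ c)
    gap k c<k k<n with view k
    ... | ‵fromℕ      = ⊥-elim (ℕₚ.<-irrefl refl k<n)
    ... | ‵inject₁ k₀ = λ k~c → after k₀ (inject₁-reflect c<k)
                                    (trans (sym (old k₀)) (trans k~c (trans (old c) c~v)))

  no-edge-from-new : ∀ {j} → ¬ Edge σ⁺ (fromℕ m) j
  no-edge-from-new {j} (n<j , _) = fromℕ-top j n<j

  block⁺ : ∀ {ℓ} → IsBlock σ ℓ → IsBlock σ⁺ ℓ
  block⁺ (i , i~ℓ) = inject₁ i , trans (old i) i~ℓ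

  block⁻ : ∀ {ℓ} → IsBlock σ⁺ ℓ → IsBlock σ ℓ ⊎ ℓ ≡ v
  block⁻ (i , i~ℓ) with view i
  ... | ‵fromℕ      = inj₂ (trans (sym i~ℓ) new)
  ... | ‵inject₁ i₀ = inj₁ (i₀ , trans (sym (old i₀)) i~ℓ)

  noncrossing⁻ : NonCrossing σ⁺ → NonCrossing σ
  noncrossing⁻ nc a b c d ab cd (a<c , c<b , b<d) =
    nc _ _ _ _ (edge-old⁺ ab) (edge-old⁺ cd) (inject₁-mono a<c , inject₁-mono c<b , inject₁-mono b<d)

  noncrossing⁺ : NonCrossing σ → (∀ {c} → LastOcc σ v c → NoEdgeOver σ c) → NonCrossing σ⁺
  noncrossing⁺ nc uncovered a b c d ab cd (a<c , c<b , b<d) with view a | view b | view c | view d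
  ... | ‵fromℕ | _ | _ | _ = no-edge-from-new ab
  ... | _ | _ | ‵fromℕ | _ = no-edge-from-new cd
  ... | _ | ‵fromℕ | _ | _ = fromℕ-top d b<d
  ... | ‵inject₁ a₀ | ‵inject₁ b₀ | ‵inject₁ c₀ | ‵inject₁ d₀ =
    nc a₀ b₀ c₀ d₀ (edge-old⁻ ab) (edge-old⁻ cd)
       (inject₁-reflect a<c , inject₁-reflect c<b , inject₁-reflect b<d)
  ... | ‵inject₁ a₀ | ‵inject₁ b₀ | ‵inject₁ c₀ | ‵fromℕ =
    uncovered (edge-new⁻ cd) a₀ b₀ (edge-old⁻ ab) (inject₁-reflect a<c) (inject₁-reflect c<b)

  nonnested⁻ : ∀ {ℓ} → NonNested σ⁺ ℓ → ℓ ≢ v → NonNested σ ℓ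
  nonnested⁻ {ℓ} nn ℓ≢v i j ij inside = nn (inject₁ i) (inject₁ j) (edge-old⁺ ij) inside⁺
    where
    inside⁺ : ∀ x → lookup σ⁺ x ≡ ℓ → (inject₁ i < x) × (x < inject₁ j)
    inside⁺ x x~ℓ with view x
    ... | ‵fromℕ      = ⊥-elim (ℓ≢v (trans (sym x~ℓ) new))
    ... | ‵inject₁ x₀ = let (i<x , x<j) = inside x₀ (trans (sym (old x₀)) x~ℓ)
                        in inject₁-mono i<x , inject₁-mono x<j

  -- A nonnested block of σ stays nonnested in σ⁺ if it has an element not
  -- after the last occurrence of v, i.e. is not enclosed by the new edge.
  nonnested⁺ : ∀ {ℓ} → NonNested σ ℓ →
               (∀ {c} → LastOcc σ v c → ∃ λ y → lookup σ y ≡ ℓ × ¬ c < y) →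
               NonNested σ⁺ ℓ
  nonnested⁺ nn early i j ij inside with view i | view j
  ... | ‵fromℕ | _ = no-edge-from-new ij
  ... | ‵inject₁ i₀ | ‵inject₁ j₀ =
    nn i₀ j₀ (edge-old⁻ ij) λ x x~ℓ →
      let (i<x , x<j) = inside (inject₁ x) (trans (old x) x~ℓ)
      in inject₁-reflect i<x , inject₁-reflect x<j
  ... | ‵inject₁ i₀ | ‵fromℕ with early (edge-new⁻ ij)
  ...   | y , y~ℓ , i≮y = i≮y (inject₁-reflect (proj₁ (inside (inject₁ y) (trans (old y) y~ℓ))))

  -- If σ⁺ is noncrossing and c is the last occurrence of v, then block v of
  -- σ is nonnested: an edge enclosing it would cross the new edge (c , n).
  lastOcc-nonnested : ∀ {c} → NonCrossing σ⁺ → LastOcc σ v c → NonNested σ v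
  lastOcc-nonnested {c} nc lc i j ij inside =
    let (i<c , c<j) = inside c (holds lc)
    in nc _ _ _ _ (edge-old⁺ ij) (edge-new⁺ lc) (inject₁-mono i<c , inject₁-mono c<j , inject₁<fromℕ j)

  -- Under the same hypotheses, a block with an element y after c lies
  -- entirely under the new edge (c , n), so it is nested in σ⁺.
  nested-after : ∀ {c y} → NonCrossing σ⁺ → LastOcc σ v c → c < y →
                 ¬ NonNested σ⁺ (lookup σ y)
  nested-after {c} {y} nc lc@(lastWith c~v after) c<y nn = nn (inject₁ c) (fromℕ m) (edge-new⁺ lc) under
    where
    y≁v : lookup σ y ≢ v
    y≁v = after y c<y
    under : ∀ x → lookup σ⁺ x ≡ lookup σ y → (inject₁ c < x) × (x < fromℕ m)
    under x x~y with view x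
    ... | ‵fromℕ = ⊥-elim (y≁v (trans (sym x~y) new))
    ... | ‵inject₁ x₀ with <-cmp x₀ c
    ...   | tri> _ _ c<x = inject₁-mono c<x , inject₁<fromℕ x₀
    ...   | tri≈ _ refl _ = ⊥-elim (y≁v (trans (sym x~y) (trans (old c) c~v)))
    ...   | tri< x<c _ _
      with edge-over σ (trans (sym (old x₀)) x~y) x<c c<y
             (λ c~x → y≁v (trans (sym (trans c~x (trans (sym (old x₀)) x~y))) c~v))
    ...     | a , b , ab , a<c , c<b , _ =
      ⊥-elim (nc _ _ _ _ (edge-old⁺ ab) (edge-new⁺ lc) (inject₁-mono a<c , inject₁-mono c<b , inject₁<fromℕ b))

  descend : ∀ {c ℓ} → NonCrossing σ⁺ → LastOcc σ v c →
            IsBlock σ⁺ ℓ × NonNested σ⁺ ℓ → IsBlock σ ℓ × NonNested σ ℓ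
  descend {c} {ℓ} nc lc (bl , nn) with ℓ ℕ.≟ v
  ... | yes refl = (c , holds lc) , lastOcc-nonnested nc lc
  ... | no ℓ≢v with block⁻ bl
  ...   | inj₁ bl₀ = bl₀ , nonnested⁻ nn ℓ≢v
  ...   | inj₂ ℓ≡v = ⊥-elim (ℓ≢v ℓ≡v)

lookup<numBlocks : ∀ {k} (σ : Vec ℕ k) i → lookup σ i ℕ.< numBlocks σ
lookup<numBlocks (x ∷ σ) zero    = ℕₚ.m≤m⊔n (suc x) (numBlocks σ)
lookup<numBlocks (x ∷ σ) (suc i) =
  ℕₚ.<-≤-trans (lookup<numBlocks σ i) (ℕₚ.m≤n⊔m (suc x) (numBlocks σ))

numBlocks-fresh : ∀ {k} (σ : Vec ℕ k) i → lookup σ i ≢ numBlocks σ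
numBlocks-fresh σ i i~n = ℕₚ.<-irrefl i~n (lookup<numBlocks σ i)

rgs-snoc : ∀ {k} b (xs : Vec ℕ k) x → RGSFrom b xs → x ≤ b ⊔ numBlocks xs → RGSFrom b (xs ∷ʳ x)
rgs-snoc b []       x _ x≤ = subst (x ≤_) (ℕₚ.⊔-identityʳ b) x≤ , tt
rgs-snoc b (y ∷ xs) x (y≤b , rest) x≤ =
  y≤b , rgs-snoc (b ⊔ suc y) xs x rest (subst (x ≤_) (sym (ℕₚ.⊔-assoc b (suc y) (numBlocks xs))) x≤)

rgs-unsnoc : ∀ {k} b (xs : Vec ℕ k) x → RGSFrom b (xs ∷ʳ x) → RGSFrom b xs × x ≤ b ⊔ numBlocks xs
rgs-unsnoc b []       x (x≤b , _) = tt , subst (x ≤_) (sym (ℕₚ.⊔-identityʳ b)) x≤b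
rgs-unsnoc b (y ∷ xs) x (y≤b , rest) =
  let (rest′ , x≤) = rgs-unsnoc (b ⊔ suc y) xs x rest
  in (y≤b , rest′) , subst (x ≤_) (ℕₚ.⊔-assoc b (suc y) (numBlocks xs)) x≤

new-label : ∀ {ℓ b y} → y ≤ b → ℓ ℕ.< b ⊔ suc y → ℓ ℕ.< b ⊎ ℓ ≡ y
new-label {ℓ} {b} {y} y≤b ℓ< with ℕₚ.⊔-sel b (suc y)
... | inj₁ ⊔≡b = inj₁ (subst (ℓ ℕ.<_) ⊔≡b ℓ<)
... | inj₂ ⊔≡y with ℓ ℕ.<? b
...   | yes ℓ<b = inj₁ ℓ<b
...   | no ℓ≮b = inj₂ (ℕₚ.≤-antisym (ℕ.s≤s⁻¹ (subst (ℓ ℕ.<_) ⊔≡y ℓ<)) (ℕₚ.≤-trans y≤b (ℕₚ.≮⇒≥ ℓ≮b)))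

rgs-labels : ∀ {k} b (xs : Vec ℕ k) ℓ → RGSFrom b xs → ℓ ℕ.< b ⊔ numBlocks xs → ℓ ℕ.< b ⊎ IsBlock xs ℓ
rgs-labels b []       ℓ _ ℓ< = inj₁ (subst (ℓ ℕ.<_) (ℕₚ.⊔-identityʳ b) ℓ<)
rgs-labels b (y ∷ xs) ℓ (y≤b , rest) ℓ<
  with rgs-labels (b ⊔ suc y) xs ℓ rest (subst (ℓ ℕ.<_) (sym (ℕₚ.⊔-assoc b (suc y) (numBlocks xs))) ℓ<)
... | inj₂ (i , i~ℓ) = inj₂ (suc i , i~ℓ)
... | inj₁ ℓ<b⊔y with new-label y≤b ℓ<b⊔y
...   | inj₁ ℓ<b  = inj₁ ℓ<b
...   | inj₂ refl = inj₂ (zero , refl)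

fresh-label : ∀ {k} (σ : Vec ℕ k) v → IsRGS (σ ∷ʳ v) → (∀ i → lookup σ i ≢ v) → v ≡ numBlocks σ
fresh-label σ v rgs unused with rgs-unsnoc 0 σ v rgs
... | rgsσ , v≤ with ℕₚ.m≤n⇒m<n∨m≡n v≤
...   | inj₂ v≡ = v≡
...   | inj₁ v< with rgs-labels 0 σ v rgsσ v<
...     | inj₁ ()
...     | inj₂ (i , i~v) = ⊥-elim (unused i i~v)

≡ᵇ-reflects : ∀ x y → Reflects (x ≡ y) (x ≡ᵇ y)
≡ᵇ-reflects x y = fromEquivalence (ℕₚ.≡ᵇ⇒≡ x y) (ℕₚ.≡⇒≡ᵇ x y)

blockSize-snoc : ∀ {k} (σ : Vec ℕ k) ℓ → blockSize (σ ∷ʳ ℓ) ℓ ≡ suc (blockSize σ ℓ)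
blockSize-snoc [] ℓ with ℓ ≡ᵇ ℓ | ≡ᵇ-reflects ℓ ℓ
... | true  | _         = refl
... | false | ofⁿ ℓ≢ℓ = ⊥-elim (ℓ≢ℓ refl)
blockSize-snoc (x ∷ σ) ℓ with x ≡ᵇ ℓ
... | true  = cong suc (blockSize-snoc σ ℓ)
... | false = blockSize-snoc σ ℓ

blockSize-pos : ∀ {k} (σ : Vec ℕ k) {ℓ} → IsBlock σ ℓ → 1 ≤ blockSize σ ℓ
blockSize-pos (x ∷ σ) {ℓ} (i , i~ℓ) with x ≡ᵇ ℓ | ≡ᵇ-reflects x ℓ | i
... | true  | _        | _     = s≤s z≤n
... | false | ofⁿ x≢ℓ | zero  = ⊥-elim (x≢ℓ i~ℓ)
... | false | _        | suc j = blockSize-pos σ (j , i~ℓ)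

blockSize-absent : ∀ {k} (σ : Vec ℕ k) {ℓ} → (∀ i → lookup σ i ≢ ℓ) → blockSize σ ℓ ≡ 0
blockSize-absent []      _      = refl
blockSize-absent (x ∷ σ) {ℓ} absent with x ≡ᵇ ℓ | ≡ᵇ-reflects x ℓ
... | true  | ofʸ x≡ℓ = ⊥-elim (absent zero x≡ℓ)
... | false | _       = blockSize-absent σ (absent ∘ suc)

Sorted : List ℕ → Set
Sorted = Linked ℕ._<_

∈⇒≢[] : ∀ {x : ℕ} {xs} → x ∈ xs → xs ≢ []
∈⇒≢[] {xs = []}    ()
∈⇒≢[] {xs = _ ∷ _} _ ()

sorted-head : ∀ {x xs} → Sorted (x ∷ xs) → All (x ℕ.<_) xs
sorted-head s with Linked⇒AllPairs ℕₚ.<-trans s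
... | x<xs ∷ _ = x<xs

elemᵇ-reflects : ∀ x X → Reflects (x ∈ X) (elemᵇ x X)
elemᵇ-reflects x []       = ofⁿ λ ()
elemᵇ-reflects x (y ∷ ys) with x ≡ᵇ y | ≡ᵇ-reflects x y
... | true  | ofʸ refl = ofʸ (here refl)
... | false | ofⁿ x≢y with elemᵇ x ys | elemᵇ-reflects x ys
...   | true  | ofʸ x∈ys = ofʸ (there x∈ys)
...   | false | ofⁿ x∉ys = ofⁿ λ { (here x≡y) → x≢y x≡y ; (there x∈ys) → x∉ys x∈ys }

distinct? : (a : ℕ) → Decidable (_≢ a)
distinct? a y = ¬? (y ℕ.≟ a)

∈-remove⁻ : ∀ {a ℓ X} → ℓ ∈ remove a X → ℓ ∈ X × ℓ ≢ a
∈-remove⁻ {a} = ∈-filter⁻ (distinct? a)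

remove-absent : ∀ a xs → a ∉ xs → remove a xs ≡ xs
remove-absent a xs a∉ = filter-all (distinct? a) (All.tabulate λ x∈ x≡a → a∉ (subst (_∈ xs) x≡a x∈))

insert : ℕ → List ℕ → List ℕ
insert v []       = v ∷ []
insert v (x ∷ xs) with v ℕ.<? x
... | yes _ = v ∷ x ∷ xs
... | no  _ = x ∷ insert v xs

insert-∈ : ∀ v xs → v ∈ insert v xs
insert-∈ v []       = here refl
insert-∈ v (x ∷ xs) with v ℕ.<? x
... | yes _ = here refl
... | no  _ = there (insert-∈ v xs)

∈-insert⁻ : ∀ {z} v xs → z ∈ insert v xs → z ≡ v ⊎ z ∈ xs
∈-insert⁻ v []       (here z≡v) = inj₁ z≡v
∈-insert⁻ v (x ∷ xs) z∈ with v ℕ.<? x | z∈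
... | yes _ | here z≡v  = inj₁ z≡v
... | yes _ | there z∈′ = inj₂ z∈′
... | no  _ | here z≡x  = inj₂ (here z≡x)
... | no  _ | there z∈′ with ∈-insert⁻ v xs z∈′
...   | inj₁ z≡v = inj₁ z≡v
...   | inj₂ z∈xs = inj₂ (there z∈xs)

insert-front : ∀ v xs → All (v ℕ.<_) xs → insert v xs ≡ v ∷ xs
insert-front v []       _           = refl
insert-front v (x ∷ xs) (v<x ∷ _) with v ℕ.<? x
... | yes _   = refl
... | no  v≮x = ⊥-elim (v≮x v<x)

insert-sorted-after : ∀ {x v} xs → x ℕ.< v → Sorted (x ∷ xs) → v ∉ xs → Sorted (x ∷ insert v xs)
insert-sorted-after []       x<v _          _  = x<v ∷ [-]
insert-sorted-after {v = v} (y ∷ ys) x<v (x<y ∷ s) v∉ with v ℕ.<? y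
... | yes v<y = x<v ∷ v<y ∷ s
... | no  v≮y = x<y ∷ insert-sorted-after ys y<v s (v∉ ∘ there)
  where
  y<v = ℕₚ.≤∧≢⇒< (ℕₚ.≮⇒≥ v≮y) (λ y≡v → v∉ (here (sym y≡v)))

insert-sorted : ∀ v xs → Sorted xs → v ∉ xs → Sorted (insert v xs)
insert-sorted v []       _ _  = [-]
insert-sorted v (x ∷ xs) s v∉ with v ℕ.<? x
... | yes v<x = v<x ∷ s
... | no  v≮x = insert-sorted-after xs x<v s (v∉ ∘ there)
  where
  x<v = ℕₚ.≤∧≢⇒< (ℕₚ.≮⇒≥ v≮x) (λ x≡v → v∉ (here (sym x≡v)))

remove-insert : ∀ v xs → v ∉ xs → remove v (insert v xs) ≡ xs
remove-insert v []       _  = filter-reject (distinct? v) (λ v≢v → v≢v refl)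
remove-insert v (x ∷ xs) v∉ with v ℕ.<? x
... | yes _ = trans (filter-reject (distinct? v) (λ v≢v → v≢v refl)) (remove-absent v (x ∷ xs) v∉)
... | no  _ = trans (filter-accept (distinct? v) (λ x≡v → v∉ (here (sym x≡v))))
                    (cong (x ∷_) (remove-insert v xs (v∉ ∘ there)))

insert-remove : ∀ a xs → Sorted xs → a ∈ xs → insert a (remove a xs) ≡ xs
insert-remove a (a ∷ xs) s (here refl) = begin
  insert a (remove a (a ∷ xs)) ≡⟨ cong (insert a) (filter-reject (distinct? a) (λ a≢a → a≢a refl)) ⟩
  insert a (remove a xs)       ≡⟨ cong (insert a) (remove-absent a xs a∉xs) ⟩
  insert a xs                  ≡⟨ insert-front a xs a<xs ⟩
  a ∷ xs                       ∎
  where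
  open ≡-Reasoning
  a<xs = sorted-head s
  a∉xs = λ a∈ → ℕₚ.<-irrefl refl (All.lookup a<xs a∈)
insert-remove a (x ∷ xs) s (there a∈) with a ℕ.<? x
... | yes a<x = ⊥-elim (ℕₚ.<-asym a<x (All.lookup (sorted-head s) a∈))
... | no  a≮x = begin
  insert a (remove a (x ∷ xs)) ≡⟨ cong (insert a) (filter-accept (distinct? a) x≢a) ⟩
  insert a (x ∷ remove a xs)   ≡⟨ insert-skip ⟩
  x ∷ insert a (remove a xs)   ≡⟨ cong (x ∷_) (insert-remove a xs (Linked.tail s) a∈) ⟩
  x ∷ xs                       ∎
  where
  open ≡-Reasoning
  x≢a : x ≢ a
  x≢a x≡a = ℕₚ.<-irrefl x≡a (All.lookup (sorted-head s) a∈)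
  insert-skip : insert a (x ∷ remove a xs) ≡ x ∷ insert a (remove a xs)
  insert-skip with a ℕ.<? x
  ... | yes a<x = ⊥-elim (a≮x a<x)
  ... | no  _   = refl

remove-injective : ∀ {a X Y} → Sorted X → Sorted Y → a ∈ X → a ∈ Y → remove a X ≡ remove a Y → X ≡ Y
remove-injective {a} {X} {Y} sX sY a∈X a∈Y eq = begin
  X                     ≡⟨ sym (insert-remove a X sX a∈X) ⟩
  insert a (remove a X) ≡⟨ cong (insert a) eq ⟩
  insert a (remove a Y) ≡⟨ insert-remove a Y sY a∈Y ⟩
  Y                     ∎
  where open ≡-Reasoning

data LastInView {k} (X : List ℕ) (σ : Vec ℕ k) : Maybe ℕ → Set where
  none : (∀ i → lookup σ i ∉ X) → LastInView X σ nothing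
  some : ∀ c → LastWith (_∈ X) σ c → LastInView X σ (just (lookup σ c))

lastIn-view : ∀ {k} X (σ : Vec ℕ k) → LastInView X σ (lastIn X σ)
lastIn-view X []       = none λ ()
lastIn-view {suc k} X (x ∷ xs) with lastIn X xs | lastIn-view X xs
... | just _  | some c (lastWith c∈X after) = some (suc c) (lastWith c∈X later)
  where
  later : ∀ y → suc c < y → lookup (x ∷ xs) y ∉ X
  later (suc y) (s≤s c<y) = after y c<y
... | nothing | none absent with elemᵇ x X | elemᵇ-reflects x X
...   | true  | ofʸ x∈X = some zero (lastWith x∈X later)
  where
  later : ∀ y → zero {n = k} < y → lookup (x ∷ xs) y ∉ X
  later (suc y) _ = absent y
...   | false | ofⁿ x∉X = none λ { zero → x∉X ; (suc i) → absent i }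

lastIn-exact : ∀ {k} {X} {σ : Vec ℕ k} {c} → LastWith (_∈ X) σ c → lastIn X σ ≡ just (lookup σ c)
lastIn-exact {X = X} {σ} lastX with lastIn X σ | lastIn-view X σ
... | _ | none absent    = ⊥-elim (absent _ (holds lastX))
... | _ | some c′ lastX′ = cong (just ∘ lookup σ) (lastWith-unique {P = _∈ X} {σ} lastX′ lastX)

-- κ (σ , X , ε): n forms a new singleton block (ε = 0), or joins the block
-- lookup σ c of X with the largest maximum, which stays in X (ε = 1) or
-- leaves it (ε = -1).
data KappaView {m} (σ : Vec ℕ m) (X : List ℕ) : Eps → Vec ℕ (suc m) × List ℕ → Set where
  fresh : KappaView σ X zer (σ ∷ʳ numBlocks σ , X)
  join  : ∀ c → LastWith (_∈ X) σ c → KappaView σ X pos (σ ∷ʳ lookup σ c , X)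
  close : ∀ c → LastWith (_∈ X) σ c →
          KappaView σ X neg (σ ∷ʳ lookup σ c , remove (lookup σ c) X)

blocks-occur : ∀ {k} {σ : Vec ℕ k} {P : ℕ → Set} {X} →
               All (λ ℓ → IsBlock σ ℓ × P ℓ) X → (∀ i → lookup σ i ∉ X) → X ≡ []
blocks-occur []                      _      = refl
blocks-occur (((i , i~ℓ) , _) ∷ _) absent = ⊥-elim (absent i (here i~ℓ))

-- For ε = ±1 the set X is nonempty, so lastIn X σ finds a block.
κ-view : ∀ {m} (σ : Vec ℕ m) X ε → IsNCNN± m (σ , X , ε) → KappaView σ X ε (κ (σ , X , ε))
κ-view σ X zer _ = fresh
κ-view σ X pos ((_ , _ , _ , blocks) , nonempty) with lastIn X σ | lastIn-view X σ
... | _ | some c lastX = join c lastX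
... | _ | none absent with nonempty (blocks-occur {σ = σ} blocks absent)
...   | ()
κ-view σ X neg ((_ , _ , _ , blocks) , nonempty) with lastIn X σ | lastIn-view X σ
... | _ | some c lastX = close c lastX
... | _ | none absent with nonempty (blocks-occur {σ = σ} blocks absent)
...   | ()

-- Appending n to the block a = lookup σ c of X with the largest maximum
-- keeps the string an RGS and the partition noncrossing, and every block of
-- X stays nonnested: the new edge ends at c, after which no block of X occurs.
join-NCNN : ∀ {m} {σ : Vec ℕ m} {X c} → LastWith (_∈ X) σ c → IsNCNN m (σ , X) →
            let σ⁺ = σ ∷ʳ lookup σ c in
            IsRGS σ⁺ × NonCrossing σ⁺ × (∀ {ℓ} → ℓ ∈ X → IsBlock σ⁺ ℓ × NonNested σ⁺ ℓ)
join-NCNN {σ = σ} {X} {c} lastX@(lastWith a∈X afterX) (rgs , nc , _ , blocks) =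
  rgs-snoc 0 σ a rgs (ℕₚ.<⇒≤ (lookup<numBlocks σ c)) ,
  noncrossing⁺ nc (lastOcc-uncovered nc (proj₂ (All.lookup blocks a∈X))) ,
  λ ℓ∈X → let (bl , nn) = All.lookup blocks ℓ∈X in block⁺ bl , nonnested⁺ nn (early bl ℓ∈X)
  where
  a = lookup σ c
  open Extension σ a
  early : ∀ {ℓ} → IsBlock σ ℓ → ℓ ∈ X → ∀ {c′} → LastOcc σ a c′ →
          ∃ λ y → lookup σ y ≡ ℓ × ¬ c′ < y
  early (i , i~ℓ) ℓ∈X lc′ with lastWith-unique {σ = σ} lc′ (lastIn⇒lastOcc {X = X} lastX)
  ... | refl = i , i~ℓ , λ c<i → afterX i c<i (subst (_∈ X) (sym i~ℓ) ℓ∈X)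

wellDefined-view : ∀ {m} {σ : Vec ℕ m} {X ε r} → KappaView σ X ε r → IsNCNN m (σ , X) → IsNCNNbar m r
wellDefined-view {σ = σ} {X} fresh (rgs , nc , sorted , blocks) =
  (rgs-snoc 0 σ v rgs ℕₚ.≤-refl ,
   noncrossing⁺ nc (⊥-elim ∘ absent) ,
   sorted ,
   All.map (λ (bl , nn) → block⁺ bl , nonnested⁺ nn (⊥-elim ∘ absent)) blocks) ,
  All.map (λ ((i , i~ℓ) , _) last≡ℓ →
             ⊥-elim (numBlocks-fresh σ i (trans i~ℓ (trans (sym last≡ℓ) (last-∷ʳ v σ))))) blocks
  where
  -- the new label numBlocks σ does not occur in σ, so there is no new edge
  v = numBlocks σ
  open Extension σ v
  absent : ∀ {c} → LastOcc σ v c → ⊥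
  absent (lastWith c~v _) = numBlocks-fresh σ _ c~v
wellDefined-view {σ = σ} (join c lastX) ncnn@(_ , _ , sorted , _) =
  let (rgs⁺ , nc⁺ , blocks⁺) = join-NCNN lastX ncnn in
  (rgs⁺ , nc⁺ , sorted , All.tabulate blocks⁺) ,
  All.tabulate λ _ last≡ℓ →
    subst (λ ℓ → 2 ≤ blockSize (σ ∷ʳ a) ℓ) (trans (sym (last-∷ʳ a σ)) last≡ℓ) two-elements
  where
  -- n joins the block a, which already contains c
  a = lookup σ c
  two-elements : 2 ≤ blockSize (σ ∷ʳ a) a
  two-elements = subst (2 ≤_) (sym (blockSize-snoc σ a)) (s≤s (blockSize-pos σ (c , refl)))
wellDefined-view {σ = σ} {X} (close c lastX) ncnn@(_ , _ , sorted , _) =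
  let (rgs⁺ , nc⁺ , blocks⁺) = join-NCNN lastX ncnn in
  (rgs⁺ , nc⁺ , filter⁺ (distinct? a) ℕₚ.<-trans sorted , All.tabulate (blocks⁺ ∘ proj₁ ∘ ∈-remove⁻ {X = X})) ,
  All.tabulate λ ℓ∈ last≡ℓ → ⊥-elim (proj₂ (∈-remove⁻ {X = X} ℓ∈) (trans (sym last≡ℓ) (last-∷ʳ a σ)))
  where
  -- the block containing n has been removed from X
  a = lookup σ c

κ-wellDefined : ∀ {m} (d : Vec ℕ m × List ℕ × Eps) → IsNCNN± m d → IsNCNNbar m (κ d)
κ-wellDefined (σ , X , ε) h = wellDefined-view (κ-view σ X ε h) (proj₁ h)

snoc-pair-injective : ∀ {m} {σ τ : Vec ℕ m} {v w : ℕ} {A B : List ℕ} →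
                      (σ ∷ʳ v , A) ≡ (τ ∷ʳ w , B) → σ ≡ τ × v ≡ w × A ≡ B
snoc-pair-injective {σ = σ} {τ} eq =
  let (σ≡τ , v≡w) = ∷ʳ-injective σ τ (cong proj₁ eq) in σ≡τ , v≡w , cong proj₂ eq

-- The image determines σ (delete n), then ε: n is a singleton exactly for
-- ε = 0, and its block is in the image set exactly for ε = 1; for ε = -1,
-- X is recovered by inserting that block back.
injective-view : ∀ {m} {σ τ : Vec ℕ m} {X Y ε ε′ r r′} →
                 KappaView σ X ε r → KappaView τ Y ε′ r′ → Sorted X → Sorted Y →
                 r ≡ r′ → (σ , X , ε) ≡ (τ , Y , ε′)
injective-view fresh fresh _ _ eq with snoc-pair-injective eq
... | refl , _ , refl = refl
injective-view {σ = σ} fresh (join c _) _ _ eq with snoc-pair-injective eq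
... | refl , n≡c , _ = ⊥-elim (numBlocks-fresh σ c (sym n≡c))
injective-view {σ = σ} fresh (close c _) _ _ eq with snoc-pair-injective eq
... | refl , n≡c , _ = ⊥-elim (numBlocks-fresh σ c (sym n≡c))
injective-view {σ = σ} (join c _) fresh _ _ eq with snoc-pair-injective eq
... | refl , c≡n , _ = ⊥-elim (numBlocks-fresh σ c c≡n)
injective-view {σ = σ} (close c _) fresh _ _ eq with snoc-pair-injective eq
... | refl , c≡n , _ = ⊥-elim (numBlocks-fresh σ c c≡n)
injective-view (join c _) (join c′ _) _ _ eq with snoc-pair-injective eq
... | refl , _ , refl = refl
injective-view {σ = σ} {Y = Y} (join c lastX) (close c′ _) _ _ eq with snoc-pair-injective eq
... | refl , a≡a′ , X≡ =
  ⊥-elim (proj₂ (∈-remove⁻ {X = Y} (subst (lookup σ c ∈_) X≡ (holds lastX))) a≡a′)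
injective-view {σ = σ} {X = X} (close c _) (join c′ lastY) _ _ eq with snoc-pair-injective eq
... | refl , a≡a′ , ≡Y =
  ⊥-elim (proj₂ (∈-remove⁻ {X = X} (subst (lookup σ c′ ∈_) (sym ≡Y) (holds lastY))) (sym a≡a′))
injective-view {σ = σ} {X = X} {Y} (close c lastX) (close c′ lastY) sX sY eq with snoc-pair-injective eq
... | refl , a≡a′ , X≡Y =
  cong (λ Z → σ , Z , neg)
    (remove-injective sX sY (holds lastX) (subst (_∈ Y) (sym a≡a′) (holds lastY))
      (trans X≡Y (cong (λ a → remove a Y) (sym a≡a′))))

κ-injective : ∀ {m} (d d′ : Vec ℕ m × List ℕ × Eps) → IsNCNN± m d → IsNCNN± m d′ →
              κ d ≡ κ d′ → d ≡ d′
κ-injective (σ , X , ε) (τ , Y , ε′) h@((_ , _ , sX , _) , _) h′@((_ , _ , sY , _) , _) =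
  injective-view (κ-view σ X ε h) (κ-view τ Y ε′ h′) sX sY

Preimage : (m : ℕ) → Vec ℕ (suc m) × List ℕ → Set
Preimage m r = ∃ λ (d : Vec ℕ m × List ℕ × Eps) → IsNCNN± m d × κ d ≡ r

κ-join : ∀ {m} {σ : Vec ℕ m} {X c} → LastWith (_∈ X) σ c → κ (σ , X , pos) ≡ (σ ∷ʳ lookup σ c , X)
κ-join lastX rewrite lastIn-exact lastX = refl

κ-close : ∀ {m} {σ : Vec ℕ m} {X c} → LastWith (_∈ X) σ c →
          κ (σ , X , neg) ≡ (σ ∷ʳ lookup σ c , remove (lookup σ c) X)
κ-close lastX rewrite lastIn-exact lastX = refl

-- v does not occur in σ: n is a singleton block, so v = numBlocks σ, no
-- block of X′ contains n (by the size condition), and ε = 0.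
preimage-fresh : ∀ {m} (σ : Vec ℕ m) v X′ → IsNCNNbar m (σ ∷ʳ v , X′) →
                 (∀ i → lookup σ i ≢ v) → Preimage m (σ ∷ʳ v , X′)
preimage-fresh σ v X′ ((rgs , nc , sorted , blocks) , bar) absent =
  (σ , X′ , zer) ,
  ((proj₁ (rgs-unsnoc 0 σ v rgs) , noncrossing⁻ nc , sorted ,
    All.tabulate λ ℓ∈ → old-block (All.lookup blocks ℓ∈) (All.lookup bar ℓ∈)) ,
   λ _ → refl) ,
  cong (λ w → σ ∷ʳ w , X′) (sym (fresh-label σ v rgs absent))
  where
  open Extension σ v
  -- block v of σ⁺ is {n}, too small to be in X′
  singleton : ¬ 2 ≤ blockSize σ⁺ v
  singleton two≤ = ℕₚ.<-irrefl refl (ℕₚ.≤-trans two≤ (ℕₚ.≤-reflexive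
    (trans (blockSize-snoc σ v) (cong suc (blockSize-absent σ absent)))))
  old-block : ∀ {ℓ} → IsBlock σ⁺ ℓ × NonNested σ⁺ ℓ → (last σ⁺ ≡ ℓ → 2 ≤ blockSize σ⁺ ℓ) →
              IsBlock σ ℓ × NonNested σ ℓ
  old-block (bl , nn) large with block⁻ bl
  ... | inj₁ (i , i~ℓ) = (i , i~ℓ) , nonnested⁻ nn (λ ℓ≡v → absent i (trans i~ℓ ℓ≡v))
  ... | inj₂ refl      = ⊥-elim (singleton (large (last-∷ʳ v σ)))

-- v occurs in σ, last at c: the blocks of X′ lie before c, so c is the last
-- position in a block of X′ ∪ {v}.  If v ∈ X′ then ε = 1.
preimage-join : ∀ {m} (σ : Vec ℕ m) v X′ {c} → IsNCNN (suc m) (σ ∷ʳ v , X′) →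
                LastOcc σ v c → v ∈ X′ → Preimage m (σ ∷ʳ v , X′)
preimage-join σ v X′ {c} (rgs , nc , sorted , blocks) lc v∈ =
  (σ , X′ , pos) ,
  ((proj₁ (rgs-unsnoc 0 σ v rgs) , noncrossing⁻ nc , sorted , All.map (descend nc lc) blocks) ,
   λ X′≡[] → ⊥-elim (∈⇒≢[] v∈ X′≡[])) ,
  (begin
    κ (σ , X′ , pos)       ≡⟨ κ-join lastX ⟩
    (σ ∷ʳ lookup σ c , X′) ≡⟨ cong (λ a → σ ∷ʳ a , X′) (holds lc) ⟩
    (σ ∷ʳ v , X′)          ∎)
  where
  open Extension σ v
  open ≡-Reasoning
  lastX : LastWith (_∈ X′) σ c
  lastX = lastWith (subst (_∈ X′) (sym (holds lc)) v∈)
                   (λ y c<y y∈ → nested-after nc lc c<y (proj₂ (All.lookup blocks y∈)))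

-- If v ∉ X′ then ε = -1 and X = X′ ∪ {v}.
preimage-close : ∀ {m} (σ : Vec ℕ m) v X′ {c} → IsNCNN (suc m) (σ ∷ʳ v , X′) →
                 LastOcc σ v c → v ∉ X′ → Preimage m (σ ∷ʳ v , X′)
preimage-close σ v X′ {c} (rgs , nc , sorted , blocks) lc v∉ =
  (σ , X , neg) ,
  ((proj₁ (rgs-unsnoc 0 σ v rgs) , noncrossing⁻ nc , insert-sorted v X′ sorted v∉ ,
    All.tabulate new-blocks) ,
   λ X≡[] → ⊥-elim (∈⇒≢[] (insert-∈ v X′) X≡[])) ,
  (begin
    κ (σ , X , neg)                          ≡⟨ κ-close lastX ⟩
    (σ ∷ʳ lookup σ c , remove (lookup σ c) X) ≡⟨ cong (λ a → σ ∷ʳ a , remove a X) (holds lc) ⟩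
    (σ ∷ʳ v , remove v X)                    ≡⟨ cong (σ ∷ʳ v ,_) (remove-insert v X′ v∉) ⟩
    (σ ∷ʳ v , X′)                            ∎)
  where
  open Extension σ v
  open ≡-Reasoning
  X = insert v X′
  new-blocks : ∀ {ℓ} → ℓ ∈ X → IsBlock σ ℓ × NonNested σ ℓ
  new-blocks ℓ∈ with ∈-insert⁻ v X′ ℓ∈
  ... | inj₁ refl = (c , holds lc) , lastOcc-nonnested nc lc
  ... | inj₂ ℓ∈X′ = descend nc lc (All.lookup blocks ℓ∈X′)
  later-outside : ∀ y → c < y → lookup σ y ∉ X
  later-outside y c<y y∈ with ∈-insert⁻ v X′ y∈
  ... | inj₁ y~v  = LastWith.later lc y c<y y~v
  ... | inj₂ y∈X′ = nested-after nc lc c<y (proj₂ (All.lookup blocks y∈X′))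
  lastX : LastWith (_∈ X) σ c
  lastX = lastWith (subst (_∈ X) (sym (holds lc)) (insert-∈ v X′)) later-outside

preimage : ∀ {m} (σ : Vec ℕ m) v X′ → IsNCNNbar m (σ ∷ʳ v , X′) → Preimage m (σ ∷ʳ v , X′)
preimage σ v X′ h with any? (λ i → lookup σ i ℕ.≟ v)
... | no absent = preimage-fresh σ v X′ h (λ i i~v → absent (i , i~v))
... | yes (i , i~v) with lastWith-exists (ℕ._≟ v) σ i i~v | v ∈? X′
...   | c , lc | yes v∈ = preimage-join  σ v X′ (proj₁ h) lc v∈
...   | c , lc | no  v∉ = preimage-close σ v X′ (proj₁ h) lc v∉

κ-surjective : ∀ {m} (r : Vec ℕ (suc m) × List ℕ) → IsNCNNbar m r → Preimage m r
κ-surjective {m} (σ⁺ , X′) h = from-initLast (initLast σ⁺)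
  where
  -- split off the last element (no 'with': IsNCNNbar mentions last σ⁺,
  -- itself computed by initLast σ⁺)
  from-initLast : (∃₂ λ σ v → σ⁺ ≡ σ ∷ʳ v) → Preimage m (σ⁺ , X′)
  from-initLast (σ , v , σ⁺≡) =
    subst (λ s → Preimage m (s , X′)) (sym σ⁺≡)
          (preimage σ v X′ (subst (λ s → IsNCNNbar m (s , X′)) σ⁺≡ h))

proposition7p4 : (m : ℕ) → 1 ≤ m →
    ((d : Vec ℕ m × List ℕ × Eps) → IsNCNN± m d → IsNCNNbar m (κ d)) ×
    ((d d′ : Vec ℕ m × List ℕ × Eps) → IsNCNN± m d → IsNCNN± m d′ →
      κ d ≡ κ d′ → d ≡ d′) ×
    ((c : Vec ℕ (suc m) × List ℕ) → IsNCNNbar m c →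
      ∃ λ (d : Vec ℕ m × List ℕ × Eps) → IsNCNN± m d × κ d ≡ c)
proposition7p4 m _ = κ-wellDefined , κ-injective , κ-surjective
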